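{- Let $n\ge 2$ and let $l\ge 0$ be an integer. For the action of the cactus group $J_n$ on $X(l,l,\dots,l)$ (all $n+1$ valences $l_1=\dots=l_n=l_\infty=l$), the element $(s_{1,n}s_{1,n-1})^{n(n+1)}$ acts as the identity.
   Context: An arc diagram of type $(l_1,\dots,l_n,l_\infty)$ consists of a circle (the boundary of a closed disc) carrying $n+1$ distinct marked points labelled $z_\infty,z_1,\dots,z_n$ (the labels $z_1,\dots,z_n$ may appear in any order), together with finitely many arcs inside the disc, pairwise non-intersecting except at endpoints, each joining two distinct marked points (several arcs may join the same pair), such that $z_k$ is an endpoint of exactly $l_k$ arcs. Diagrams are considered up to continuous deformation; $X(l_1,\dots,l_n,l_\infty)$ is the set of all of them. Going clockwise from $z_\infty$, the other marked points occupy positions $1,\dots,n$. The cactus group $J_n$ has generators $s_{p,q}$ ($1\le p<q\le n$) and relations $s_{p,q}^2=e$; $s_{p,q}s_{p',q'}=s_{p',q'}s_{p,q}$ if $[p,q]\cap[p',q']=\emptyset$; $s_{p,q}s_{p',q'}s_{p,q}=s_{p+q-q',p+q-p'}$ if $p\le p'<q'\le q$. It acts on $X(l_1,\dots,l_n,l_\infty)$ as follows: for $s_{p,q}$, take a chord $c$ separating the points in positions $p,\dots,q$ from the other marked points (arcs deformed to cross $c$ at most once), reflect the part of the diagram on the side of $c$ not containing $z_\infty$ across the perpendicular bisector of $c$ (reversing the order of the points in positions $p,\dots,q$ and of the crossing points on $c$), and rejoin the arc pieces across $c$. Products act right to left. -}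

module Defs where

open import Data.Nat using (ℕ; zero; suc; _+_; _*_; _∸_; _≤_; _<_; _≤ᵇ_; _<ᵇ_)
open import Data.Bool using (Bool; true; false; if_then_else_; _∧_; not)
open import Data.List using (List; []; _∷_; map; length; upTo; applyUpTo; concat; replicate)
open import Data.List.Relation.Binary.Permutation.Propositional using (_↭_)
open import Data.Product using (_×_; _,_; ∃-syntax)
open import Relation.Binary.PropositionalEquality using (_≡_)
open import Relation.Nullary using (¬_)
open import Data.Empty using (⊥)

-- Marked points occupy positions 0 (z_∞), 1, …, n clockwise.  Each marked
-- point in position b is "blown up" into l consecutive endpoint slots
-- b*l, …, b*l + l - 1 (the order in which the arc ends arrive at it,
-- clockwise).  A diagram up to deformation is then exactly
--   * the labels of positions 1..n (a permutation of 1..n), and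
--   * a fixed-point-free involution on the slots 0 … (n+1)*l - 1
--     (arc = pair of matched slots) which is non-crossing and never
--     matches two slots of the same marked point.

-- total list lookup (default 0 outside the range)
nth : List ℕ → ℕ → ℕ
nth []       _       = 0
nth (x ∷ xs) zero    = x
nth (x ∷ xs) (suc i) = nth xs i

filterᵇ : (ℕ → Bool) → List ℕ → List ℕ
filterᵇ f []       = []
filterᵇ f (x ∷ xs) = if f x then x ∷ filterᵇ f xs else filterᵇ f xs

-- number of entries of the list strictly below x
-- (= the index of x if the list is increasing and contains x)
rank : ℕ → List ℕ → ℕ
rank x xs = length (filterᵇ (λ y → y <ᵇ x) xs)

slots : ℕ → ℕ → ℕ
slots n l = suc n * l

record Diagram : Set where
  constructor diagram
  field
    labels : List ℕ   -- labels (k of z_k) of the points in positions 1..n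
    arcs   : List ℕ   -- arcs i = slot matched with slot i

open Diagram public

SameBlock : ℕ → ℕ → ℕ → Set
SameBlock l i j = ∃[ b ] (b * l ≤ i × i < b * l + l × b * l ≤ j × j < b * l + l)

record IsArcDiagram (n l : ℕ) (D : Diagram) : Set where
  field
    labelsPerm : labels D ↭ applyUpTo suc n
    arcsLength : length (arcs D) ≡ slots n l
    inRange    : ∀ i → i < slots n l → nth (arcs D) i < slots n l
    involutive : ∀ i → i < slots n l → nth (arcs D) (nth (arcs D) i) ≡ i
    noSelf     : ∀ i → i < slots n l → ¬ SameBlock l i (nth (arcs D) i)
    nonCrossing : ∀ a b → a < slots n l → b < slots n l →
                  a < b → b < nth (arcs D) a → nth (arcs D) a < nth (arcs D) b → ⊥

record X (n l : ℕ) : Set where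
  constructor mkX
  field
    diag  : Diagram
    valid : IsArcDiagram n l diag

-- The positions p..q occupy the slot interval I = [p*l, (q+1)*l).
-- Reflection reverses I: r x = p*l + (q+1)*l - 1 - x.
-- Arcs with both ends outside I are kept; arcs with both ends inside I
-- are reflected; the arcs crossing the chord c are cut: their inside
-- ends C (increasing = order of crossing points along c) are reflected,
-- the crossing points reversed, and the pieces rejoined, i.e. the outside
-- end that was attached to the k-th element of C gets attached to the
-- k-th element of r(C) (both sorted increasingly).

module _ (n l p q : ℕ) (M : List ℕ) where
  private
    lo hi N : ℕ
    lo = p * l
    hi = suc q * l
    N  = slots n l
    inI : ℕ → Bool
    inI x = (lo ≤ᵇ x) ∧ (x <ᵇ hi)
    r : ℕ → ℕ
    r x = (lo + hi) ∸ suc x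
    m : ℕ → ℕ
    m = nth M
    C rC : List ℕ
    C  = filterᵇ (λ x → inI x ∧ not (inI (m x))) (upTo N)
    rC = filterᵇ (λ x → inI x ∧ not (inI (m (r x)))) (upTo N)

  newPartner : ℕ → ℕ
  newPartner x =
    if inI x
    then (if inI (m (r x)) then r (m (r x)) else m (nth C (rank x rC)))
    else (if inI (m x) then nth rC (rank (m x) C) else m x)

  actArcs : List ℕ
  actArcs = map newPartner (upTo N)

-- reverse the labels in positions p..q (list index k = position k+1)
actLabels : ℕ → ℕ → ℕ → List ℕ → List ℕ
actLabels n p q L =
  map (λ k → if (p ≤ᵇ suc k) ∧ (suc k ≤ᵇ q) then nth L ((p + q) ∸ suc (suc k)) else nth L k)
      (upTo n)

actGen : ℕ → ℕ → ℕ × ℕ → Diagram → Diagram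
actGen n l (p , q) D = diagram (actLabels n p q (labels D)) (actArcs n l p q (arcs D))

-- words in the generators s_{p,q}, acting right to left
act : ℕ → ℕ → List (ℕ × ℕ) → Diagram → Diagram
act n l []      D = D
act n l (g ∷ w) D = actGen n l g (act n l w D)

theWord : ℕ → List (ℕ × ℕ)
theWord n = concat (replicate (n * suc n) ((1 , n) ∷ (1 , n ∸ 1) ∷ []))

{-# OPTIONS --safe #-}
module Submission where

-- Every marked point is blown up into l consecutive slots, so that a diagram is a labelling together with a
-- non-crossing matching m of the slots 0 … N ∸ 1, z_∞ owning the first l of them.  If the reflection r of the
-- slots cut off by the chord of s_{p,q} extends to an involution τ of all slots that reverses the order of the
-- outside and fixes the arcs lying outside, then s_{p,q} acts on m as conjugation by τ: the cut arcs are
-- reattached in reversed order, just as τ reattaches them.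
--
-- For s_{1,n-1} the outside consists of z_∞ and the point in position n, which are adjacent on the circle; the
-- arcs between them form a rainbow around the gap, so τ can be the full reflection ρ x = N ∸ 1 ∸ x.  For s_{1,n}
-- the outside is z_∞ alone and τ reverses its slots and the remaining ones separately.  So s_{1,n} s_{1,n-1}
-- conjugates m by ρ ∘ τ, the rotation by one block, of order n + 1, and rotates the n labels cyclically, of
-- order n; hence n (n + 1) rounds act trivially.

open import Defs
open import Data.Bool using (Bool; true; false; if_then_else_)
open import Data.Empty using (⊥; ⊥-elim)
open import Data.List using (List; []; _∷_; _∷ʳ_; map; length; upTo; applyUpTo; reverse; filter; concat; replicate)
open import Data.List.Membership.Propositional using (_∈_)
open import Data.List.Membership.Propositional.Properties
  using (∈-map⁺; ∈-map⁻; ∈-filter⁺; ∈-filter⁻; ∈-upTo⁺; ∈-upTo⁻)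
open import Data.List.Properties
  using (length-applyUpTo; length-map; length-upTo; length-reverse; unfold-reverse;
         filter-accept; filter-reject; filter-none)
open import Data.List.Relation.Binary.Permutation.Propositional.Properties using (↭-length)
open import Data.List.Relation.Unary.All as All using (All; []; _∷_)
open import Data.List.Relation.Unary.AllPairs using (AllPairs; []; _∷_)
import Data.List.Relation.Unary.AllPairs.Properties as AllPairs
open import Data.List.Relation.Unary.Any using (here; there)
open import Data.List.Relation.Unary.Any.Properties using (reverse⁺; reverse⁻)
open import Data.Nat using (ℕ; zero; suc; pred; _+_; _*_; _∸_; _≤_; _<_; z≤n; s≤s; >-nonZero)
open import Data.Nat.GeneralisedArithmetic using (iterate; fold)
open import Data.Nat.Properties
open import Data.Product using (_×_; _,_; proj₁; proj₂; ∃-syntax)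
open import Data.Sum using (_⊎_; inj₁; inj₂)
open import Function using (_∘_; flip)
open import Relation.Binary.Definitions using (tri<; tri≈; tri>)
open import Relation.Binary.PropositionalEquality
open import Relation.Nullary using (¬_; does; yes; no; _×-dec_; ¬?)
open import Relation.Nullary.Decidable using (dec-true; dec-false)
open import Relation.Unary using (Pred; Decidable)

-- Increasing lists of naturals

Increasing : List ℕ → Set
Increasing = AllPairs _<_

filterᵇ-does : ∀ {p} {P : Pred ℕ p} (P? : Decidable P) xs → filterᵇ (does ∘ P?) xs ≡ filter P? xs
filterᵇ-does P? [] = refl
filterᵇ-does P? (x ∷ xs) with does (P? x)
... | true  = cong (x ∷_) (filterᵇ-does P? xs)
... | false = filterᵇ-does P? xs

nth-map : ∀ (f : ℕ → ℕ) xs {i} → i < length xs → nth (map f xs) i ≡ f (nth xs i)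
nth-map f (x ∷ xs) {zero}  _         = refl
nth-map f (x ∷ xs) {suc i} (s≤s i<n) = nth-map f xs i<n

nth-map-upTo : ∀ (f : ℕ → ℕ) N {i} → i < N → nth (map f (upTo N)) i ≡ f i
nth-map-upTo f N = go (λ i → i) N
  where
  go : ∀ g N {i} → i < N → nth (map f (applyUpTo g N)) i ≡ f (g i)
  go g (suc N) {zero}  _         = refl
  go g (suc N) {suc i} (s≤s i<N) = go (g ∘ suc) N i<N

nth-∈ : ∀ xs {i} → i < length xs → nth xs i ∈ xs
nth-∈ (x ∷ xs) {zero}  _         = here refl
nth-∈ (x ∷ xs) {suc i} (s≤s i<n) = there (nth-∈ xs i<n)

∈⇒nth : ∀ {xs y} → y ∈ xs → ∃[ i ] (i < length xs × nth xs i ≡ y)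
∈⇒nth (here refl) = zero , s≤s z≤n , refl
∈⇒nth (there y∈)  with i , i<n , eq ← ∈⇒nth y∈ = suc i , s≤s i<n , eq

≡-from-nth : ∀ xs ys → length xs ≡ length ys →
             (∀ i → i < length xs → nth xs i ≡ nth ys i) → xs ≡ ys
≡-from-nth []       []       _   _  = refl
≡-from-nth (x ∷ xs) (y ∷ ys) len eq =
  cong₂ _∷_ (eq zero (s≤s z≤n)) (≡-from-nth xs ys (suc-injective len) (λ i i<n → eq (suc i) (s≤s i<n)))

nth-∷ʳ : ∀ xs x {i} → i < length xs → nth (xs ∷ʳ x) i ≡ nth xs i
nth-∷ʳ (y ∷ xs) x {zero}  _         = refl
nth-∷ʳ (y ∷ xs) x {suc i} (s≤s i<n) = nth-∷ʳ xs x i<n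

nth-∷ʳ-length : ∀ xs x → nth (xs ∷ʳ x) (length xs) ≡ x
nth-∷ʳ-length []       x = refl
nth-∷ʳ-length (y ∷ xs) x = nth-∷ʳ-length xs x

nth-reverse : ∀ xs {i} → i < length xs → nth (reverse xs) i ≡ nth xs (length xs ∸ suc i)
nth-reverse (x ∷ xs) {i} i≤n rewrite unfold-reverse x xs with <-cmp i (length xs)
... | tri< i<n _ _ = begin
  nth (reverse xs ∷ʳ x) i            ≡⟨ nth-∷ʳ (reverse xs) x (subst (i <_) (sym (length-reverse xs)) i<n) ⟩
  nth (reverse xs) i                 ≡⟨ nth-reverse xs i<n ⟩
  nth xs (length xs ∸ suc i)         ≡⟨ cong (nth (x ∷ xs)) (+-∸-assoc 1 i<n) ⟨
  nth (x ∷ xs) (length xs ∸ i)       ∎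
  where open ≡-Reasoning
... | tri≈ _ refl _ = begin
  nth (reverse xs ∷ʳ x) (length xs)  ≡⟨ cong (nth (reverse xs ∷ʳ x)) (length-reverse xs) ⟨
  nth (reverse xs ∷ʳ x) (length (reverse xs)) ≡⟨ nth-∷ʳ-length (reverse xs) x ⟩
  x                                  ≡⟨ cong (nth (x ∷ xs)) (n∸n≡0 (length xs)) ⟨
  nth (x ∷ xs) (length xs ∸ length xs) ∎
  where open ≡-Reasoning
... | tri> _ _ i>n = ⊥-elim (<⇒≱ i>n (≤-pred i≤n))

upTo-increasing : ∀ N → Increasing (upTo N)
upTo-increasing N = AllPairs.applyUpTo⁺₁ (λ i → i) N (λ i<j _ → i<j)

module _ {p} {P : Pred ℕ p} (P? : Decidable P) (N : ℕ) where

  ∈-filterᵇ-upTo⁻ : ∀ {x} → x ∈ filterᵇ (does ∘ P?) (upTo N) → x < N × P x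
  ∈-filterᵇ-upTo⁻ x∈ with x∈upTo , Px ← ∈-filter⁻ P? (subst (_ ∈_) (filterᵇ-does P? (upTo N)) x∈) =
    ∈-upTo⁻ x∈upTo , Px

  ∈-filterᵇ-upTo⁺ : ∀ {x} → x < N → P x → x ∈ filterᵇ (does ∘ P?) (upTo N)
  ∈-filterᵇ-upTo⁺ x<N Px = subst (_ ∈_) (sym (filterᵇ-does P? (upTo N))) (∈-filter⁺ P? (∈-upTo⁺ x<N) Px)

  filterᵇ-upTo-increasing : Increasing (filterᵇ (does ∘ P?) (upTo N))
  filterᵇ-upTo-increasing =
    subst Increasing (sym (filterᵇ-does P? (upTo N))) (AllPairs.filter⁺ P? (upTo-increasing N))

rank-nth : ∀ xs {i} → Increasing xs → i < length xs → rank (nth xs i) xs ≡ i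
rank-nth xs {i} xs↑ i<n = trans (cong length (filterᵇ-does (_<? nth xs i) xs)) (go xs xs↑ i<n)
  where
  go : ∀ xs {i} → Increasing xs → i < length xs → length (filter (_<? nth xs i) xs) ≡ i
  go (x ∷ xs) {zero} (x<xs ∷ _) _
    rewrite filter-reject (_<? x) {x} {xs} (<-irrefl refl)
          | filter-none (_<? x) (All.map <⇒≯ x<xs) = refl
  go (x ∷ xs) {suc i} (x<xs ∷ xs↑) (s≤s i<n)
    rewrite filter-accept (_<? nth xs i) {x} {xs} (All.lookup x<xs (nth-∈ xs i<n)) = cong suc (go xs xs↑ i<n)

AllPairs-reverse : ∀ {R : ℕ → ℕ → Set} {xs} → AllPairs (flip R) xs → AllPairs R (reverse xs)
AllPairs-reverse {xs = []}     []         = []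
AllPairs-reverse {xs = x ∷ xs} (Rx ∷ Rxs) rewrite unfold-reverse x xs =
  AllPairs.++⁺ (AllPairs-reverse Rxs) ([] ∷ []) (All.tabulate (λ y∈ → All.lookup Rx (reverse⁻ y∈) ∷ []))

increasing-unique : ∀ {xs ys} → Increasing xs → Increasing ys →
                    (∀ {y} → y ∈ xs → y ∈ ys) → (∀ {y} → y ∈ ys → y ∈ xs) → xs ≡ ys
increasing-unique {[]}     {[]}     _ _ _ _ = refl
increasing-unique {[]}     {y ∷ ys} _ _ _ ⊇ with () ← ⊇ (here refl)
increasing-unique {x ∷ xs} {[]}     _ _ ⊆ _ with () ← ⊆ (here refl)
increasing-unique {x ∷ xs} {y ∷ ys} (x<xs ∷ xs↑) (y<ys ∷ ys↑) ⊆ ⊇ =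
  cong₂ _∷_ x≡y
    (increasing-unique xs↑ ys↑ (tail⊆ x<xs x≡y (⊆ ∘ there)) (tail⊆ y<ys (sym x≡y) (⊇ ∘ there)))
  where
  x≡y : x ≡ y
  x≡y with ⊆ (here refl) | ⊇ (here refl)
  ... | here x≡y | _        = x≡y
  ... | there _  | here y≡x = sym y≡x
  ... | there x∈ | there y∈ = ⊥-elim (<-asym (All.lookup y<ys x∈) (All.lookup x<xs y∈))
  tail⊆ : ∀ {a b as bs} → All (a <_) as → a ≡ b → (∀ {z} → z ∈ as → z ∈ b ∷ bs) →
          ∀ {z} → z ∈ as → z ∈ bs
  tail⊆ a<as refl ⊆′ z∈ with ⊆′ z∈
  ... | here refl  = ⊥-elim (<-irrefl refl (All.lookup a<as z∈))
  ... | there z∈bs = z∈bs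

m∸[1+[m∸[1+n]]]≡n : ∀ {m n} → n < m → m ∸ suc (m ∸ suc n) ≡ n
m∸[1+[m∸[1+n]]]≡n {m} n<m = trans (cong (m ∸_) (sym (+-∸-assoc 1 n<m))) (m∸[m∸n]≡n (<⇒≤ n<m))

m∸[1+n]<m : ∀ {m n} → n < m → m ∸ suc n < m
m∸[1+n]<m n<m = ∸-monoʳ-< (s≤s z≤n) n<m

no-between⇒suc≡ : ∀ {a b} → a < b → (∀ z → a < z → z < b → ⊥) → suc a ≡ b
no-between⇒suc≡ {a} {b} a<b none with <-cmp (suc a) b
... | tri< a+1<b _ _ = ⊥-elim (none (suc a) ≤-refl a+1<b)
... | tri≈ _ a+1≡b _ = a+1≡b
... | tri> _ _ b<a+1 = ⊥-elim (<⇒≱ a<b (≤-pred b<a+1))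

module _ (f : ℕ → ℕ) {xs ys : List ℕ} (xs↑ : Increasing xs) (ys↑ : Increasing ys)
         (into : ∀ {a} → a ∈ xs → f a ∈ ys) (onto : ∀ {b} → b ∈ ys → ∃[ a ] (a ∈ xs × f a ≡ b))
         (antitone : ∀ {a b} → a ∈ xs → b ∈ xs → a < b → f b < f a) where

  map-reverse-antitone : map f (reverse xs) ≡ ys
  map-reverse-antitone = increasing-unique (AllPairs.map⁺ (AllPairs-reverse (pairs xs↑ antitone))) ys↑ ⊆ ⊇
    where
    pairs : ∀ {zs} → Increasing zs → (∀ {a b} → a ∈ zs → b ∈ zs → a < b → f b < f a) →
            AllPairs (λ a b → f b < f a) zs
    pairs []            _    = []
    pairs (z<zs ∷ zs↑) anti =
      All.tabulate (λ b∈ → anti (here refl) (there b∈) (All.lookup z<zs b∈)) ∷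
      pairs zs↑ (λ a∈ b∈ → anti (there a∈) (there b∈))
    ⊆ : ∀ {y} → y ∈ map f (reverse xs) → y ∈ ys
    ⊆ y∈ with a , a∈ , refl ← ∈-map⁻ f y∈ = into (reverse⁻ a∈)
    ⊇ : ∀ {y} → y ∈ ys → y ∈ map f (reverse xs)
    ⊇ y∈ with a , a∈ , refl ← onto y∈ = ∈-map⁺ f (reverse⁺ a∈)

  length-antitone : length ys ≡ length xs
  length-antitone = begin
    length ys                   ≡⟨ cong length map-reverse-antitone ⟨
    length (map f (reverse xs)) ≡⟨ length-map f (reverse xs) ⟩
    length (reverse xs)         ≡⟨ length-reverse xs ⟩
    length xs                   ∎
    where open ≡-Reasoning

  nth-antitone : ∀ {i} → i < length xs → f (nth xs i) ≡ nth ys (length xs ∸ suc i)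
  nth-antitone {i} i<n = begin
    f (nth xs i)                       ≡⟨ cong (f ∘ nth xs) (m∸[1+[m∸[1+n]]]≡n i<n) ⟨
    f (nth xs (length xs ∸ suc j))     ≡⟨ cong f (nth-reverse xs j<n) ⟨
    f (nth (reverse xs) j)             ≡⟨ nth-map f (reverse xs) (subst (j <_) (sym (length-reverse xs)) j<n) ⟨
    nth (map f (reverse xs)) j         ≡⟨ cong (λ zs → nth zs j) map-reverse-antitone ⟩
    nth ys j                           ∎
    where
    open ≡-Reasoning
    j = length xs ∸ suc i
    j<n : j < length xs
    j<n = m∸[1+n]<m i<n

-- Reflections and non-crossing matchings

Within : ℕ → ℕ → ℕ → Set
Within lo hi x = lo ≤ x × x < hi

within? : ∀ lo hi → Decidable (Within lo hi)
within? lo hi x = lo ≤? x ×-dec x <? hi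

reflectIn : ℕ → ℕ → ℕ → ℕ
reflectIn lo hi x = (lo + hi) ∸ suc x

module _ {lo hi : ℕ} where

  reflectIn-within : ∀ {x} → Within lo hi x → Within lo hi (reflectIn lo hi x)
  reflectIn-within {x} (lo≤x , x<hi) =
    m+n≤o⇒m≤o∸n lo (+-monoʳ-≤ lo x<hi) ,
    m<n+o⇒m∸n<o (lo + hi) (suc x) {{>-nonZero (≤-<-trans z≤n x<hi)}} (+-monoˡ-< hi (s≤s lo≤x))

  reflectIn-involutive : ∀ {x} → x < lo + hi → reflectIn lo hi (reflectIn lo hi x) ≡ x
  reflectIn-involutive = m∸[1+[m∸[1+n]]]≡n

  reflectIn-antitone : ∀ {x y} → x < y → y < lo + hi → reflectIn lo hi y < reflectIn lo hi x
  reflectIn-antitone x<y y<lo+hi = ∸-monoʳ-< (s≤s x<y) y<lo+hi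

record IsNonCrossingMatching (N : ℕ) (m : ℕ → ℕ) : Set where
  field
    bounded     : ∀ x → x < N → m x < N
    involutive  : ∀ x → x < N → m (m x) ≡ x
    nonCrossing : ∀ a b → a < N → b < N → a < b → b < m a → m a < m b → ⊥

  injective : ∀ {x y} → x < N → y < N → m x ≡ m y → x ≡ y
  injective {x} {y} x<N y<N eq = trans (sym (involutive x x<N)) (trans (cong m eq) (involutive y y<N))

IsNonCrossingMatching-resp : ∀ {N f g} → (∀ x → x < N → f x ≡ g x) →
                             IsNonCrossingMatching N g → IsNonCrossingMatching N f
IsNonCrossingMatching-resp {N} {f} {g} f≗g M = record
  { bounded     = bounded′
  ; involutive  = λ x x<N → trans (f≗g _ (bounded′ x x<N)) (trans (cong g (f≗g x x<N)) (involutive x x<N))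
  ; nonCrossing = λ a b a<N b<N a<b b<fa fa<fb →
      nonCrossing a b a<N b<N a<b (subst (b <_) (f≗g a a<N) b<fa) (subst₂ _<_ (f≗g a a<N) (f≗g b b<N) fa<fb)
  }
  where
  open IsNonCrossingMatching M
  bounded′ : ∀ x → x < N → f x < N
  bounded′ x x<N = subst (_< N) (sym (f≗g x x<N)) (bounded x x<N)

-- The reflections of a circle of N slots are exactly the maps reversing both arcs [0, s) and [s, N).
record IsCircleReflection (N s : ℕ) (τ : ℕ → ℕ) : Set where
  field
    bounded    : ∀ x → x < N → τ x < N
    involutive : ∀ x → x < N → τ (τ x) ≡ x
    below      : ∀ x → x < s → τ x < s
    above      : ∀ x → s ≤ x → x < N → s ≤ τ x
    antitone   : ∀ a b → a < b → b < N → b < s ⊎ s ≤ a → τ b < τ a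

conjugate-nonCrossing : ∀ {N s τ m} → IsCircleReflection N s τ → IsNonCrossingMatching N m →
                        IsNonCrossingMatching N (τ ∘ m ∘ τ)
conjugate-nonCrossing {N} {s} {τ} {m} T M = record
  { bounded     = bounded′
  ; involutive  = λ x x<N → begin
      τ (m (τ (τ (m (τ x))))) ≡⟨ cong (τ ∘ m) (T.involutive _ (M.bounded _ (T.bounded x x<N))) ⟩
      τ (m (m (τ x)))         ≡⟨ cong τ (M.involutive _ (T.bounded x x<N)) ⟩
      τ (τ x)                 ≡⟨ T.involutive x x<N ⟩
      x                       ∎
  ; nonCrossing = crossing⇒⊥
  }
  where
  open ≡-Reasoning
  module T = IsCircleReflection T
  module M = IsNonCrossingMatching M
  bounded′ : ∀ x → x < N → τ (m (τ x)) < N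
  bounded′ x x<N = T.bounded _ (M.bounded _ (T.bounded x x<N))
  crossing⇒⊥ : ∀ a b → a < N → b < N → a < b → b < τ (m (τ a)) → τ (m (τ a)) < τ (m (τ b)) → ⊥
  crossing⇒⊥ a b a<N b<N a<b b<c c<d = cases
    where
    A = τ a
    B = τ b
    c = τ (m A)
    d = τ (m B)
    A<N = T.bounded a a<N
    B<N = T.bounded b b<N
    c<N = bounded′ a a<N
    d<N = bounded′ b b<N
    τc : τ c ≡ m A
    τc = T.involutive _ (M.bounded _ A<N)
    τd : τ d ≡ m B
    τd = T.involutive _ (M.bounded _ B<N)
    mmA = M.involutive A A<N
    mmB = M.involutive B B<N
    -- Wherever s falls among a < b < c < d, the τ-images of these four slots form a crossing of m.
    cases : ⊥
    cases with d <? s | c <? s | b <? s | a <? s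
    ... | yes d<s | _ | _ | _ =
      M.nonCrossing (m B) (m A) (M.bounded _ B<N) (M.bounded _ A<N)
        (subst₂ _<_ τd τc (T.antitone c d c<d d<N (inj₁ d<s)))
        (subst (m A <_) (sym mmB) (subst (_< B) τc (T.antitone b c b<c c<N (inj₁ (<-trans c<d d<s)))))
        (subst₂ _<_ (sym mmB) (sym mmA) (T.antitone a b a<b b<N (inj₁ (<-trans b<c (<-trans c<d d<s)))))
    ... | no d≮s | yes c<s | _ | _ =
      M.nonCrossing (m A) B (M.bounded _ A<N) B<N
        (subst (_< B) τc (T.antitone b c b<c c<N (inj₁ c<s)))
        (subst (B <_) (sym mmA) (T.antitone a b a<b b<N (inj₁ (<-trans b<c c<s))))
        (subst (_< m B) (sym mmA)
          (<-≤-trans (T.below a (<-trans a<b (<-trans b<c c<s)))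
                     (subst (s ≤_) τd (T.above d (≮⇒≥ d≮s) d<N))))
    ... | no d≮s | no c≮s | yes b<s | _ =
      M.nonCrossing B A B<N A<N
        (T.antitone a b a<b b<N (inj₁ b<s))
        (<-≤-trans (T.below a (<-trans a<b b<s)) (subst (s ≤_) τd (T.above d (≮⇒≥ d≮s) d<N)))
        (subst₂ _<_ τd τc (T.antitone c d c<d d<N (inj₂ (≮⇒≥ c≮s))))
    ... | no d≮s | no c≮s | no b≮s | yes a<s =
      M.nonCrossing A (m B) A<N (M.bounded _ B<N)
        (<-≤-trans (T.below a a<s) (subst (s ≤_) τd (T.above d (≮⇒≥ d≮s) d<N)))
        (subst₂ _<_ τd τc (T.antitone c d c<d d<N (inj₂ (≮⇒≥ c≮s))))
        (subst (m A <_) (sym mmB) (subst (_< B) τc (T.antitone b c b<c c<N (inj₂ (≮⇒≥ b≮s)))))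
    ... | no d≮s | no c≮s | no b≮s | no a≮s =
      M.nonCrossing (m B) (m A) (M.bounded _ B<N) (M.bounded _ A<N)
        (subst₂ _<_ τd τc (T.antitone c d c<d d<N (inj₂ (≮⇒≥ c≮s))))
        (subst (m A <_) (sym mmB) (subst (_< B) τc (T.antitone b c b<c c<N (inj₂ (≮⇒≥ b≮s)))))
        (subst₂ _<_ (sym mmB) (sym mmA) (T.antitone a b a<b b<N (inj₂ (≮⇒≥ a≮s))))

reflectIn-isCircleReflection : ∀ {N} → IsCircleReflection N N (reflectIn 0 N)
reflectIn-isCircleReflection {N} = record
  { bounded    = λ x x<N → proj₂ (reflectIn-within (z≤n , x<N))
  ; involutive = λ x → reflectIn-involutive {0} {N}
  ; below      = λ x x<N → proj₂ (reflectIn-within (z≤n , x<N))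
  ; above      = λ x N≤x x<N → ⊥-elim (<⇒≱ x<N N≤x)
  ; antitone   = λ a b a<b b<N _ → reflectIn-antitone {0} {N} a<b b<N
  }

reflectCircle : ℕ → ℕ → ℕ → ℕ
reflectCircle N s x = if does (x <? s) then reflectIn 0 s x else reflectIn s N x

module _ {N s : ℕ} where

  reflectCircle-below : ∀ {x} → x < s → reflectCircle N s x ≡ reflectIn 0 s x
  reflectCircle-below {x} x<s rewrite dec-true (x <? s) x<s = refl

  reflectCircle-above : ∀ {x} → s ≤ x → reflectCircle N s x ≡ reflectIn s N x
  reflectCircle-above {x} s≤x rewrite dec-false (x <? s) (≤⇒≯ s≤x) = refl

  reflectCircle-isCircleReflection : s ≤ N → IsCircleReflection N s (reflectCircle N s)
  reflectCircle-isCircleReflection s≤N = record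
    { bounded    = bounded
    ; involutive = involutive
    ; below      = λ x x<s → subst (_< s) (sym (reflectCircle-below x<s)) (proj₂ (reflectIn-within (z≤n , x<s)))
    ; above      = λ x s≤x x<N →
        subst (s ≤_) (sym (reflectCircle-above s≤x)) (proj₁ (reflectIn-within (s≤x , x<N)))
    ; antitone   = antitone
    }
    where
    τ = reflectCircle N s
    <s+N : ∀ {x} → x < N → x < s + N
    <s+N x<N = <-≤-trans x<N (m≤n+m N s)
    bounded : ∀ x → x < N → τ x < N
    bounded x x<N with x <? s
    ... | yes x<s = subst (_< N) (sym (reflectCircle-below x<s))
                      (<-≤-trans (proj₂ (reflectIn-within (z≤n , x<s))) s≤N)
    ... | no  x≮s = subst (_< N) (sym (reflectCircle-above (≮⇒≥ x≮s)))
                      (proj₂ (reflectIn-within (≮⇒≥ x≮s , x<N)))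
    involutive : ∀ x → x < N → τ (τ x) ≡ x
    involutive x x<N with x <? s
    ... | yes x<s rewrite reflectCircle-below x<s =
      trans (reflectCircle-below (proj₂ (reflectIn-within (z≤n , x<s)))) (reflectIn-involutive {0} {s} x<s)
    ... | no  x≮s rewrite reflectCircle-above (≮⇒≥ x≮s) =
      trans (reflectCircle-above (proj₁ (reflectIn-within (≮⇒≥ x≮s , x<N))))
            (reflectIn-involutive {s} {N} (<s+N x<N))
    antitone : ∀ a b → a < b → b < N → b < s ⊎ s ≤ a → τ b < τ a
    antitone a b a<b b<N (inj₁ b<s) =
      subst₂ _<_ (sym (reflectCircle-below b<s)) (sym (reflectCircle-below (<-trans a<b b<s)))
        (reflectIn-antitone {0} {s} a<b b<s)
    antitone a b a<b b<N (inj₂ s≤a) =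
      subst₂ _<_ (sym (reflectCircle-above (≤-trans s≤a (<⇒≤ a<b)))) (sym (reflectCircle-above s≤a))
        (reflectIn-antitone {s} {N} a<b (<s+N b<N))

-- Rejoining the arcs cut by a chord

module ChordReflection (N lo hi : ℕ) (m : ℕ → ℕ) where

  Inside : ℕ → Set
  Inside = Within lo hi

  r : ℕ → ℕ
  r = reflectIn lo hi

  Crossing MirrorCrossing : ℕ → Set
  Crossing x       = Inside x × ¬ Inside (m x)
  MirrorCrossing x = Inside x × ¬ Inside (m (r x))

  crossing? : Decidable Crossing
  crossing? x = within? lo hi x ×-dec ¬? (within? lo hi (m x))

  mirrorCrossing? : Decidable MirrorCrossing
  mirrorCrossing? x = within? lo hi x ×-dec ¬? (within? lo hi (m (r x)))

  -- cut, cut′ and rejoin restate the private C, rC and newPartner of Defs; nth-actArcs identifies them.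
  cut cut′ : List ℕ
  cut  = filterᵇ (does ∘ crossing?) (upTo N)
  cut′ = filterᵇ (does ∘ mirrorCrossing?) (upTo N)

  rejoin : ℕ → ℕ
  rejoin x =
    if does (within? lo hi x)
    then (if does (within? lo hi (m (r x))) then r (m (r x)) else m (nth cut (rank x cut′)))
    else (if does (within? lo hi (m x)) then nth cut′ (rank (m x) cut) else m x)

  rejoin-in-in : ∀ {x} → Inside x → Inside (m (r x)) → rejoin x ≡ r (m (r x))
  rejoin-in-in {x} x∈ mrx∈
    rewrite dec-true (within? lo hi x) x∈ | dec-true (within? lo hi (m (r x))) mrx∈ = refl

  rejoin-in-out : ∀ {x} → Inside x → ¬ Inside (m (r x)) → rejoin x ≡ m (nth cut (rank x cut′))
  rejoin-in-out {x} x∈ mrx∉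
    rewrite dec-true (within? lo hi x) x∈ | dec-false (within? lo hi (m (r x))) mrx∉ = refl

  rejoin-out-in : ∀ {x} → ¬ Inside x → Inside (m x) → rejoin x ≡ nth cut′ (rank (m x) cut)
  rejoin-out-in {x} x∉ mx∈
    rewrite dec-false (within? lo hi x) x∉ | dec-true (within? lo hi (m x)) mx∈ = refl

  rejoin-out-out : ∀ {x} → ¬ Inside x → ¬ Inside (m x) → rejoin x ≡ m x
  rejoin-out-out {x} x∉ mx∉
    rewrite dec-false (within? lo hi x) x∉ | dec-false (within? lo hi (m x)) mx∉ = refl

  ∈-cut⁻ : ∀ {c} → c ∈ cut → c < N × Crossing c
  ∈-cut⁻ = ∈-filterᵇ-upTo⁻ crossing? N

  ∈-cut⁺ : ∀ {c} → c < N → Crossing c → c ∈ cut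
  ∈-cut⁺ = ∈-filterᵇ-upTo⁺ crossing? N

  ∈-cut′⁻ : ∀ {c} → c ∈ cut′ → c < N × MirrorCrossing c
  ∈-cut′⁻ = ∈-filterᵇ-upTo⁻ mirrorCrossing? N

  ∈-cut′⁺ : ∀ {c} → c < N → MirrorCrossing c → c ∈ cut′
  ∈-cut′⁺ = ∈-filterᵇ-upTo⁺ mirrorCrossing? N

  cut-increasing : Increasing cut
  cut-increasing = filterᵇ-upTo-increasing crossing? N

  cut′-increasing : Increasing cut′
  cut′-increasing = filterᵇ-upTo-increasing mirrorCrossing? N

  -- o precedes o′ on the outer side of the chord, read from lo ∸ 1 down to 0 and on from N ∸ 1 down to hi.
  Precedes : ℕ → ℕ → Set
  Precedes o o′ = (o′ < o × o < lo) ⊎ (o′ < o × hi ≤ o′) ⊎ (o < lo × hi ≤ o′)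

  outside : ∀ {o} → ¬ Inside o → o < lo ⊎ hi ≤ o
  outside {o} o∉ with o <? lo
  ... | yes o<lo = inj₁ o<lo
  ... | no  o≮lo = inj₂ (≮⇒≥ (λ o<hi → o∉ (≮⇒≥ o≮lo , o<hi)))

  record IsCutSymmetry (τ : ℕ → ℕ) : Set where
    field
      bounded          : ∀ x → x < N → τ x < N
      involutive       : ∀ x → x < N → τ (τ x) ≡ x
      reflects-inside  : ∀ x → Inside x → τ x ≡ r x
      reverses-outside : ∀ o o′ → o < N → o′ < N → ¬ Inside o → ¬ Inside o′ →
                         Precedes o o′ → Precedes (τ o′) (τ o)
      fixes-outer-arcs : ∀ o → o < N → ¬ Inside o → ¬ Inside (m o) → τ (m (τ o)) ≡ m o

    preserves-outside : ∀ o → o < N → ¬ Inside o → ¬ Inside (τ o)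
    preserves-outside o o<N o∉ τo∈ =
      o∉ (subst Inside (trans (sym (reflects-inside _ τo∈)) (involutive o o<N)) (reflectIn-within τo∈))

  module _ (lo≤hi : lo ≤ hi) (hi≤N : hi ≤ N) (M : IsNonCrossingMatching N m)
           {τ : ℕ → ℕ} (S : IsCutSymmetry τ) where

    open IsNonCrossingMatching M
    module S = IsCutSymmetry S

    inside<N : ∀ {x} → Inside x → x < N
    inside<N (_ , x<hi) = <-≤-trans x<hi hi≤N

    inside<lo+hi : ∀ {x} → Inside x → x < lo + hi
    inside<lo+hi (_ , x<hi) = <-≤-trans x<hi (m≤n+m hi lo)

    r-involutive : ∀ {x} → x < lo + hi → r (r x) ≡ x
    r-involutive = reflectIn-involutive {lo} {hi}

    precedes-irreflexive : ∀ {o} → ¬ Precedes o o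
    precedes-irreflexive (inj₁ (o<o , _))        = <-irrefl refl o<o
    precedes-irreflexive (inj₂ (inj₁ (o<o , _))) = <-irrefl refl o<o
    precedes-irreflexive (inj₂ (inj₂ (o<lo , hi≤o))) = <-irrefl refl (<-≤-trans o<lo (≤-trans lo≤hi hi≤o))

    precedes-total : ∀ {o o′} → ¬ Inside o → ¬ Inside o′ → o ≢ o′ → Precedes o o′ ⊎ Precedes o′ o
    precedes-total {o} {o′} o∉ o′∉ o≢o′ with outside o∉ | outside o′∉ | <-cmp o o′
    ... | inj₁ o<lo  | inj₂ hi≤o′ | _            = inj₁ (inj₂ (inj₂ (o<lo , hi≤o′)))
    ... | inj₂ hi≤o  | inj₁ o′<lo | _            = inj₂ (inj₂ (inj₂ (o′<lo , hi≤o)))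
    ... | inj₁ o<lo  | inj₁ o′<lo | tri< o<o′ _ _ = inj₂ (inj₁ (o<o′ , o′<lo))
    ... | inj₁ o<lo  | inj₁ _     | tri> _ _ o′<o = inj₁ (inj₁ (o′<o , o<lo))
    ... | inj₂ hi≤o  | inj₂ _     | tri< o<o′ _ _ = inj₂ (inj₂ (inj₁ (o<o′ , hi≤o)))
    ... | inj₂ _     | inj₂ hi≤o′ | tri> _ _ o′<o = inj₁ (inj₂ (inj₁ (o′<o , hi≤o′)))
    ... | _          | _          | tri≈ _ o≡o′ _ = ⊥-elim (o≢o′ o≡o′)

    inner-ends-ordered : ∀ o o′ → o < N → o′ < N → Inside (m o) → Inside (m o′) →
                         Precedes o o′ → m o < m o′
    inner-ends-ordered o o′ o<N o′<N mo∈ mo′∈ o≺o′ with <-cmp (m o) (m o′)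
    ... | tri< mo<mo′ _ _ = mo<mo′
    ... | tri≈ _ mo≡mo′ _ =
      ⊥-elim (precedes-irreflexive (subst (Precedes o) (sym (injective o<N o′<N mo≡mo′)) o≺o′))
    ... | tri> _ _ mo′<mo = ⊥-elim (crossing o≺o′)
      where
      crossing : Precedes o o′ → ⊥
      crossing (inj₁ (o′<o , o<lo)) =
        nonCrossing o′ o o′<N o<N o′<o (<-≤-trans o<lo (proj₁ mo′∈)) mo′<mo
      crossing (inj₂ (inj₁ (o′<o , hi≤o′))) =
        nonCrossing (m o′) (m o) (bounded o′ o′<N) (bounded o o<N) mo′<mo
          (subst (m o <_) (sym (involutive o′ o′<N)) (<-≤-trans (proj₂ mo∈) hi≤o′))
          (subst₂ _<_ (sym (involutive o′ o′<N)) (sym (involutive o o<N)) o′<o)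
      crossing (inj₂ (inj₂ (o<lo , hi≤o′))) =
        nonCrossing o (m o′) o<N (bounded o′ o′<N) (<-≤-trans o<lo (proj₁ mo′∈)) mo′<mo
          (subst (m o <_) (sym (involutive o′ o′<N)) (<-≤-trans (proj₂ mo∈) hi≤o′))

    crossing-preserved : ∀ o → o < N → ¬ Inside o → Inside (m o) → Inside (m (τ o))
    crossing-preserved o o<N o∉ mo∈ with within? lo hi (m (τ o))
    ... | yes mτo∈ = mτo∈
    ... | no  mτo∉ = ⊥-elim (mτo∉ (subst Inside r[mo]≡mτo (reflectIn-within mo∈)))
      where
      open ≡-Reasoning
      r[mo]≡mτo : r (m o) ≡ m (τ o)
      r[mo]≡mτo = begin
        r (m o)           ≡⟨ S.reflects-inside (m o) mo∈ ⟨
        τ (m o)           ≡⟨ cong (τ ∘ m) (S.involutive o o<N) ⟨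
        τ (m (τ (τ o)))   ≡⟨ S.fixes-outer-arcs (τ o) (S.bounded o o<N)
                                (S.preserves-outside o o<N o∉) mτo∉ ⟩
        m (τ o)           ∎

    outer-ends-precede : ∀ {c c′} → c ∈ cut → c′ ∈ cut → c < c′ → Precedes (m c) (m c′)
    outer-ends-precede {c} {c′} c∈ c′∈ c<c′
      with c<N , c∈I , mc∉ ← ∈-cut⁻ c∈ | c′<N , c′∈I , mc′∉ ← ∈-cut⁻ c′∈
      with precedes-total mc∉ mc′∉ (λ mc≡mc′ → <-irrefl (injective c<N c′<N mc≡mc′) c<c′)
    ... | inj₁ mc≺mc′ = mc≺mc′
    ... | inj₂ mc′≺mc = ⊥-elim (<-asym c<c′ (subst₂ _<_ (involutive c′ c′<N) (involutive c c<N)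
            (inner-ends-ordered (m c′) (m c) (bounded c′ c′<N) (bounded c c<N)
              (subst Inside (sym (involutive c′ c′<N)) c′∈I) (subst Inside (sym (involutive c c<N)) c∈I)
              mc′≺mc)))

    -- The permutation of the cut arcs induced by τ, read at their inner ends.
    φ : ℕ → ℕ
    φ c = m (τ (m c))

    φ-inside : ∀ {c} → c ∈ cut → Inside (φ c)
    φ-inside {c} c∈ with c<N , c∈I , mc∉ ← ∈-cut⁻ c∈ =
      crossing-preserved (m c) (bounded c c<N) mc∉ (subst Inside (sym (involutive c c<N)) c∈I)

    φ-cut : ∀ {c} → c ∈ cut → φ c ∈ cut
    φ-cut {c} c∈ with c<N , _ , mc∉ ← ∈-cut⁻ c∈ =
      ∈-cut⁺ (bounded _ τmc<N)
        (φ-inside c∈ , subst (¬_ ∘ Inside) (sym (involutive _ τmc<N)) (S.preserves-outside (m c) mc<N mc∉))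
      where
      mc<N = bounded c c<N
      τmc<N = S.bounded (m c) mc<N

    φ-involutive : ∀ {c} → c ∈ cut → φ (φ c) ≡ c
    φ-involutive {c} c∈ with c<N , _ ← ∈-cut⁻ c∈ = begin
      m (τ (m (m (τ (m c))))) ≡⟨ cong (m ∘ τ) (involutive _ (S.bounded _ (bounded c c<N))) ⟩
      m (τ (τ (m c)))         ≡⟨ cong m (S.involutive _ (bounded c c<N)) ⟩
      m (m c)                 ≡⟨ involutive c c<N ⟩
      c                       ∎
      where open ≡-Reasoning

    φ-antitone : ∀ {a b} → a ∈ cut → b ∈ cut → a < b → φ b < φ a
    φ-antitone {a} {b} a∈ b∈ a<b with a<N , _ , ma∉ ← ∈-cut⁻ a∈ | b<N , _ , mb∉ ← ∈-cut⁻ b∈ =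
      inner-ends-ordered (τ (m b)) (τ (m a)) (S.bounded _ (bounded b b<N)) (S.bounded _ (bounded a a<N))
        (φ-inside b∈) (φ-inside a∈)
        (S.reverses-outside (m a) (m b) (bounded a a<N) (bounded b b<N) ma∉ mb∉ (outer-ends-precede a∈ b∈ a<b))

    r-cut : ∀ {c} → c ∈ cut → r c ∈ cut′
    r-cut {c} c∈ with _ , c∈I , mc∉ ← ∈-cut⁻ c∈ =
      ∈-cut′⁺ (inside<N (reflectIn-within c∈I))
        (reflectIn-within c∈I , subst (¬_ ∘ Inside ∘ m) (sym (r-involutive (inside<lo+hi c∈I))) mc∉)

    r-cut′ : ∀ {c} → c ∈ cut′ → r c ∈ cut
    r-cut′ {c} c∈ with _ , c∈I , mrc∉ ← ∈-cut′⁻ c∈ =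
      ∈-cut⁺ (inside<N (reflectIn-within c∈I)) (reflectIn-within c∈I , mrc∉)

    r-onto-cut′ : ∀ {b} → b ∈ cut′ → ∃[ a ] (a ∈ cut × r a ≡ b)
    r-onto-cut′ b∈ = _ , r-cut′ b∈ , r-involutive (inside<lo+hi (proj₁ (proj₂ (∈-cut′⁻ b∈))))

    r-antitone : ∀ {a b} → a ∈ cut → b ∈ cut → a < b → r b < r a
    r-antitone a∈ b∈ a<b = reflectIn-antitone {lo} {hi} a<b (inside<lo+hi (proj₁ (proj₂ (∈-cut⁻ b∈))))

    φ-onto-cut : ∀ {b} → b ∈ cut → ∃[ a ] (a ∈ cut × φ a ≡ b)
    φ-onto-cut b∈ = _ , φ-cut b∈ , φ-involutive b∈

    φ-mirror : ∀ {i} → i < length cut → φ (nth cut i) ≡ nth cut (length cut ∸ suc i)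
    φ-mirror = nth-antitone φ cut-increasing cut-increasing φ-cut φ-onto-cut φ-antitone

    r-mirror : ∀ {i} → i < length cut → r (nth cut i) ≡ nth cut′ (length cut ∸ suc i)
    r-mirror = nth-antitone r cut-increasing cut′-increasing r-cut r-onto-cut′ r-antitone

    length-cut′ : length cut′ ≡ length cut
    length-cut′ = length-antitone r cut-increasing cut′-increasing r-cut r-onto-cut′ r-antitone

    rejoin-conjugate-inner-arc : ∀ {x} → Inside x → Inside (m (r x)) → rejoin x ≡ τ (m (τ x))
    rejoin-conjugate-inner-arc {x} x∈ mrx∈ = begin
      rejoin x     ≡⟨ rejoin-in-in x∈ mrx∈ ⟩
      r (m (r x))  ≡⟨ S.reflects-inside _ mrx∈ ⟨
      τ (m (r x))  ≡⟨ cong (τ ∘ m) (S.reflects-inside x x∈) ⟨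
      τ (m (τ x))  ∎
      where open ≡-Reasoning

    rejoin-conjugate-inner-end : ∀ {x} → Inside x → ¬ Inside (m (r x)) → rejoin x ≡ τ (m (τ x))
    rejoin-conjugate-inner-end {x} x∈ mrx∉
      with i , i<k , nth≡rx ← ∈⇒nth (∈-cut⁺ (inside<N (reflectIn-within x∈)) (reflectIn-within x∈ , mrx∉))
      = begin
      rejoin x                   ≡⟨ rejoin-in-out x∈ mrx∉ ⟩
      m (nth cut (rank x cut′))  ≡⟨ cong (m ∘ nth cut) rank≡j ⟩
      m (nth cut j)              ≡⟨ cong m (φ-mirror i<k) ⟨
      m (φ (nth cut i))          ≡⟨ cong (m ∘ φ) nth≡rx ⟩
      m (φ (r x))                ≡⟨ involutive _ (S.bounded _ (bounded _ (inside<N (reflectIn-within x∈)))) ⟩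
      τ (m (r x))                ≡⟨ cong (τ ∘ m) (S.reflects-inside x x∈) ⟨
      τ (m (τ x))                ∎
      where
      open ≡-Reasoning
      j = length cut ∸ suc i
      rank≡j : rank x cut′ ≡ j
      rank≡j = begin
        rank x cut′                ≡⟨ cong (λ y → rank y cut′) (r-involutive (inside<lo+hi x∈)) ⟨
        rank (r (r x)) cut′        ≡⟨ cong (λ y → rank (r y) cut′) nth≡rx ⟨
        rank (r (nth cut i)) cut′  ≡⟨ cong (λ y → rank y cut′) (r-mirror i<k) ⟩
        rank (nth cut′ j) cut′     ≡⟨ rank-nth cut′ cut′-increasing
                                        (subst (j <_) (sym length-cut′) (m∸[1+n]<m i<k)) ⟩
        j                          ∎

    rejoin-conjugate-outer-end : ∀ {x} → x < N → ¬ Inside x → Inside (m x) → rejoin x ≡ τ (m (τ x))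
    rejoin-conjugate-outer-end {x} x<N x∉ mx∈
      with i , i<k , nth≡mx ← ∈⇒nth (∈-cut⁺ (bounded x x<N)
                                              (mx∈ , subst (¬_ ∘ Inside) (sym (involutive x x<N)) x∉))
      = begin
      rejoin x                         ≡⟨ rejoin-out-in x∉ mx∈ ⟩
      nth cut′ (rank (m x) cut)        ≡⟨ cong (λ y → nth cut′ (rank y cut)) nth≡mx ⟨
      nth cut′ (rank (nth cut i) cut)  ≡⟨ cong (nth cut′) (rank-nth cut cut-increasing i<k) ⟩
      nth cut′ i                       ≡⟨ cong (nth cut′) (m∸[1+[m∸[1+n]]]≡n i<k) ⟨
      nth cut′ (length cut ∸ suc j)    ≡⟨ r-mirror (m∸[1+n]<m i<k) ⟨
      r (nth cut j)                    ≡⟨ cong r (φ-mirror i<k) ⟨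
      r (φ (nth cut i))                ≡⟨ cong (r ∘ φ) nth≡mx ⟩
      r (m (τ (m (m x))))              ≡⟨ cong (r ∘ m ∘ τ) (involutive x x<N) ⟩
      r (m (τ x))                      ≡⟨ S.reflects-inside _ (crossing-preserved x x<N x∉ mx∈) ⟨
      τ (m (τ x))                      ∎
      where
      open ≡-Reasoning
      j = length cut ∸ suc i

    rejoin-conjugate : ∀ x → x < N → rejoin x ≡ τ (m (τ x))
    rejoin-conjugate x x<N with within? lo hi x | within? lo hi (m (r x)) | within? lo hi (m x)
    ... | yes x∈ | yes mrx∈ | _       = rejoin-conjugate-inner-arc x∈ mrx∈
    ... | yes x∈ | no  mrx∉ | _       = rejoin-conjugate-inner-end x∈ mrx∉
    ... | no  x∉ | _        | yes mx∈ = rejoin-conjugate-outer-end x<N x∉ mx∈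
    ... | no  x∉ | _        | no  mx∉ = trans (rejoin-out-out x∉ mx∉) (sym (S.fixes-outer-arcs x x<N x∉ mx∉))

nth-actArcs : ∀ n l p q M {x} → x < slots n l →
              nth (actArcs n l p q M) x ≡ ChordReflection.rejoin (slots n l) (p * l) (suc q * l) (nth M) x
nth-actArcs n l p q M = nth-map-upTo _ (slots n l)

-- The generators s_{1,n-1} and s_{1,n}

record IsArcMatching (n l : ℕ) (m : ℕ → ℕ) : Set where
  field
    isNonCrossingMatching : IsNonCrossingMatching (slots n l) m
    noLoop                : ∀ x → x < slots n l → ¬ SameBlock l x (m x)

  open IsNonCrossingMatching isNonCrossingMatching public

-- Slot 0 and slot N ∸ 1 are adjacent on the circle, so the arcs between z_∞ (block 0) and the point in position n
-- (block n) are nested around that gap.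
module Rainbow {n l : ℕ} (1≤n : 1 ≤ n) {m : ℕ → ℕ} (A : IsArcMatching n l m) where

  open IsArcMatching A

  N = slots n l
  ρ = reflectIn 0 N

  l≤nl : l ≤ n * l
  l≤nl = subst (_≤ n * l) (+-identityʳ l) (*-monoˡ-≤ l 1≤n)

  first-block : ∀ {x y} → x < l → y < l → SameBlock l x y
  first-block x<l y<l = 0 , z≤n , x<l , z≤n , y<l

  last-block : ∀ {x y} → n * l ≤ x → x < N → n * l ≤ y → y < N → SameBlock l x y
  last-block {x} {y} nl≤x x<N nl≤y y<N =
    n , nl≤x , subst (x <_) (+-comm l (n * l)) x<N , nl≤y , subst (y <_) (+-comm l (n * l)) y<N

  <l⇒<N : ∀ {x} → x < l → x < N
  <l⇒<N x<l = <-≤-trans x<l (m≤m+n l (n * l))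

  leaves-last-block : ∀ z → n * l ≤ z → z < N → m z < n * l
  leaves-last-block z nl≤z z<N with n * l ≤? m z
  ... | yes nl≤mz = ⊥-elim (noLoop z z<N (last-block nl≤z z<N nl≤mz (bounded z z<N)))
  ... | no  mz≱nl = ≰⇒> mz≱nl

  -- For a = 0 any U ≤ N will do; otherwise U has to be the partner of a ∸ 1.
  nothing-between : ∀ a U → a < l → n * l ≤ m a → U ≤ N → (∀ a′ → a ≡ suc a′ → m a′ ≡ U) →
                    ∀ z → m a < z → z < U → ⊥
  nothing-between a U a<l nl≤ma U≤N previous z ma<z z<U with <-cmp (m z) a
  ... | tri≈ _ mz≡a _ = <-irrefl (trans (sym (cong m mz≡a)) (involutive z z<N)) ma<z
    where z<N = <-≤-trans z<U U≤N
  ... | tri> _ _ a<mz =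
    nonCrossing a (m z) (<l⇒<N a<l) (bounded z z<N) a<mz
      (<-≤-trans (leaves-last-block z (≤-trans nl≤ma (<⇒≤ ma<z)) z<N) nl≤ma)
      (subst (m a <_) (sym (involutive z z<N)) ma<z)
    where z<N = <-≤-trans z<U U≤N
  ... | tri< mz<a _ _ with a | previous
  ...   | zero   | _    = n≮0 mz<a
  ...   | suc a′ | prev with <-cmp (m z) a′
  ...     | tri< mz<a′ _ _ =
    nonCrossing (m z) a′ (bounded z z<N) a′<N mz<a′
      (subst (a′ <_) (sym (involutive z z<N)) a′<z)
      (subst₂ _<_ (sym (involutive z z<N)) (sym (prev a′ refl)) z<U)
    where
    z<N = <-≤-trans z<U U≤N
    a′<N = <l⇒<N (<-trans (n<1+n a′) a<l)
    a′<z = <-trans (n<1+n a′) (<-≤-trans a<l (≤-trans l≤nl (≤-trans nl≤ma (<⇒≤ ma<z))))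
  ...     | tri≈ _ mz≡a′ _ =
    <-irrefl (trans (sym (involutive z (<-≤-trans z<U U≤N))) (trans (cong m mz≡a′) (prev a′ refl))) z<U
  ...     | tri> _ _ a′<mz = <-irrefl refl (<-≤-trans mz<a a′<mz)

  rainbow : ∀ o → o < l → n * l ≤ m o → m o ≡ ρ o
  rainbow zero 0<l nl≤m0 =
    cong pred (no-between⇒suc≡ (bounded 0 0<N) (nothing-between 0 N 0<l nl≤m0 ≤-refl (λ _ ())))
    where 0<N = <l⇒<N 0<l
  rainbow (suc o) o+1<l nl≤mo+1 = begin
    m (suc o)          ≡⟨ cong pred (no-between⇒suc≡ mo+1<mo (nothing-between (suc o) (m o) o+1<l nl≤mo+1
                                                                 (<⇒≤ (bounded o o<N)) (λ { _ refl → refl }))) ⟩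
    pred (m o)         ≡⟨ cong pred (rainbow o o<l nl≤mo) ⟩
    pred (N ∸ suc o)   ≡⟨ pred[m∸n]≡m∸[1+n] N (suc o) ⟩
    N ∸ suc (suc o)    ∎
    where
    open ≡-Reasoning
    o<l = <-trans (n<1+n o) o+1<l
    o<N = <l⇒<N o<l
    o+1<N = <l⇒<N o+1<l
    nl≤mo : n * l ≤ m o
    nl≤mo with m o <? l | n * l ≤? m o
    ... | yes mo<l | _        = ⊥-elim (noLoop o o<N (first-block o<l mo<l))
    ... | no _     | yes nl≤mo = nl≤mo
    ... | no mo≮l  | no mo≱nl = ⊥-elim (nonCrossing o (suc o) o<N o+1<N (n<1+n o)
                                   (<-≤-trans o+1<l (≮⇒≥ mo≮l)) (<-≤-trans (≰⇒> mo≱nl) nl≤mo+1))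
    mo+1<mo : m (suc o) < m o
    mo+1<mo with <-cmp (m (suc o)) (m o)
    ... | tri< lt _ _ = lt
    ... | tri≈ _ eq _ = ⊥-elim (<-irrefl (injective o<N o+1<N (sym eq)) (n<1+n o))
    ... | tri> _ _ gt =
      ⊥-elim (nonCrossing o (suc o) o<N o+1<N (n<1+n o) (<-≤-trans o+1<l (≤-trans l≤nl nl≤mo)) gt)

  rainbow-symmetric : ∀ o → o < N → o < l ⊎ n * l ≤ o → m o < l ⊎ n * l ≤ m o → m o ≡ ρ o
  rainbow-symmetric o o<N (inj₁ o<l)  (inj₁ mo<l)  = ⊥-elim (noLoop o o<N (first-block o<l mo<l))
  rainbow-symmetric o o<N (inj₁ o<l)  (inj₂ nl≤mo) = rainbow o o<l nl≤mo
  rainbow-symmetric o o<N (inj₂ nl≤o) (inj₁ mo<l)  = begin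
    m o          ≡⟨ reflectIn-involutive {0} {N} (bounded o o<N) ⟨
    ρ (ρ (m o))  ≡⟨ cong ρ (rainbow (m o) mo<l (subst (n * l ≤_) (sym (involutive o o<N)) nl≤o)) ⟨
    ρ (m (m o))  ≡⟨ cong ρ (involutive o o<N) ⟩
    ρ o          ∎
    where open ≡-Reasoning
  rainbow-symmetric o o<N (inj₂ nl≤o) (inj₂ nl≤mo) =
    ⊥-elim (noLoop o o<N (last-block nl≤o o<N nl≤mo (bounded o o<N)))

  ρ-first→last : ∀ x → x < l → n * l ≤ ρ x
  ρ-first→last x x<l =
    m+n≤o⇒m≤o∸n (n * l) (subst (n * l + suc x ≤_) (+-comm (n * l) l) (+-monoʳ-≤ (n * l) x<l))

  ρ-last→first : ∀ x → n * l ≤ x → x < N → ρ x < l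
  ρ-last→first x nl≤x x<N =
    m<n+o⇒m∸n<o N (suc x) {{>-nonZero 0<l}} (subst (_< suc x + l) (+-comm (n * l) l) (+-monoˡ-< l (s≤s nl≤x)))
    where
    0<l : 0 < l
    0<l = +-cancelʳ-< (n * l) 0 l (≤-<-trans nl≤x x<N)

  open ChordReflection N l (n * l) m using (Inside; Precedes; IsCutSymmetry; outside; rejoin; rejoin-conjugate)

  ρ-isCutSymmetry : IsCutSymmetry ρ
  ρ-isCutSymmetry = record
    { bounded          = IsCircleReflection.bounded reflectIn-isCircleReflection
    ; involutive       = IsCircleReflection.involutive reflectIn-isCircleReflection
    ; reflects-inside  = λ _ _ → refl
    ; reverses-outside = reverses-outside
    ; fixes-outer-arcs = λ o o<N o∉ mo∉ →
        let mo≡ρo = rainbow-symmetric o o<N (outside o∉) (outside mo∉) in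
        trans (cong (ρ ∘ m) (sym mo≡ρo)) (trans (cong ρ (involutive o o<N)) (sym mo≡ρo))
    }
    where
    reverses-outside : ∀ o o′ → o < N → o′ < N → ¬ Inside o → ¬ Inside o′ →
                       Precedes o o′ → Precedes (ρ o′) (ρ o)
    reverses-outside o o′ o<N o′<N _ _ (inj₁ (o′<o , o<l)) =
      inj₂ (inj₁ (reflectIn-antitone {0} {N} o′<o o<N , ρ-first→last o o<l))
    reverses-outside o o′ o<N o′<N _ _ (inj₂ (inj₁ (o′<o , nl≤o′))) =
      inj₁ (reflectIn-antitone {0} {N} o′<o o<N , ρ-last→first o′ nl≤o′ o′<N)
    reverses-outside o o′ o<N o′<N _ _ (inj₂ (inj₂ (o<l , nl≤o′))) =
      inj₂ (inj₂ (ρ-last→first o′ nl≤o′ o′<N , ρ-first→last o o<l))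

  rejoin-ρ : ∀ x → x < N → rejoin x ≡ ρ (m (ρ x))
  rejoin-ρ = rejoin-conjugate l≤nl (m≤n+m (n * l) l) isNonCrossingMatching ρ-isCutSymmetry

module _ {N l : ℕ} (l≤N : l ≤ N) {m : ℕ → ℕ} (M : IsNonCrossingMatching N m)
         (first-block-leaves : ∀ o → o < l → l ≤ m o) where

  open IsNonCrossingMatching M
  open ChordReflection N l N m using (Inside; Precedes; IsCutSymmetry; outside; rejoin; rejoin-conjugate)

  private
    τ = reflectCircle N l
    module τ = IsCircleReflection (reflectCircle-isCircleReflection {N} {l} l≤N)

  reflectCircle-isCutSymmetry : IsCutSymmetry τ
  reflectCircle-isCutSymmetry = record
    { bounded          = τ.bounded
    ; involutive       = τ.involutive
    ; reflects-inside  = λ x x∈ → reflectCircle-above (proj₁ x∈)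
    ; reverses-outside = reverses-outside
    ; fixes-outer-arcs = λ o o<N o∉ mo∉ → ⊥-elim (mo∉ (first-block-leaves o (below o<N o∉) , bounded o o<N))
    }
    where
    below : ∀ {o} → o < N → ¬ Inside o → o < l
    below o<N o∉ with outside o∉
    ... | inj₁ o<l  = o<l
    ... | inj₂ N≤o  = ⊥-elim (<⇒≱ o<N N≤o)
    reverses-outside : ∀ o o′ → o < N → o′ < N → ¬ Inside o → ¬ Inside o′ →
                       Precedes o o′ → Precedes (τ o′) (τ o)
    reverses-outside o o′ o<N o′<N _ _ (inj₁ (o′<o , o<l)) =
      inj₁ (τ.antitone o′ o o′<o o<N (inj₁ o<l) , τ.below o′ (<-trans o′<o o<l))
    reverses-outside o o′ o<N o′<N _ _ (inj₂ (inj₁ (_ , N≤o′))) = ⊥-elim (<⇒≱ o′<N N≤o′)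
    reverses-outside o o′ o<N o′<N _ _ (inj₂ (inj₂ (_ , N≤o′))) = ⊥-elim (<⇒≱ o′<N N≤o′)

  rejoin-reflectCircle : ∀ x → x < N → rejoin x ≡ reflectCircle N l (m (reflectCircle N l x))
  rejoin-reflectCircle = rejoin-conjugate l≤N ≤-refl M reflectCircle-isCutSymmetry

-- Rotation by one block

iterate-+ : ∀ (f : ℕ → ℕ) a b {x} → iterate f x (a + b) ≡ iterate f (iterate f x a) b
iterate-+ f zero    b     = refl
iterate-+ f (suc a) b {x} = iterate-+ f a b {f x}

iterate-periodic : ∀ (f : ℕ → ℕ) {S c} → (∀ y → y < S → iterate f y c ≡ y) →
                   ∀ a {x} → x < S → iterate f x (a * c) ≡ x
iterate-periodic f     periodic zero    x<S = refl
iterate-periodic f {c = c} periodic (suc a) {x} x<S =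
  trans (iterate-+ f c (a * c))
        (trans (cong (λ y → iterate f y (a * c)) (periodic x x<S)) (iterate-periodic f periodic a x<S))

rotate : ℕ → ℕ → ℕ → ℕ
rotate L K x = if does (x <? L) then x + K * L else x ∸ L

module _ {L K : ℕ} where

  rotate-first : ∀ {x} → x < L → rotate L K x ≡ x + K * L
  rotate-first {x} x<L rewrite dec-true (x <? L) x<L = refl

  rotate-rest : ∀ {x} → L ≤ x → rotate L K x ≡ x ∸ L
  rotate-rest {x} L≤x rewrite dec-false (x <? L) (≤⇒≯ L≤x) = refl

  block-decomposition : ∀ B x → x < B * L → ∃[ b ] ∃[ e ] (b < B × e < L × x ≡ b * L + e)
  block-decomposition (suc B) x x<B+1L with x <? L
  ... | yes x<L = 0 , x , s≤s z≤n , x<L , refl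
  ... | no  x≮L
    with b , e , b<B , e<L , x∸L≡ ← block-decomposition B (x ∸ L)
           (subst (x ∸ L <_) (m+n∸m≡n L (B * L)) (∸-monoˡ-< x<B+1L (≮⇒≥ x≮L))) =
    suc b , e , s≤s b<B , e<L ,
    trans (sym (m+[n∸m]≡n (≮⇒≥ x≮L))) (trans (cong (L +_) x∸L≡) (sym (+-assoc L (b * L) e)))

  rotate-block : ∀ b e → e < L → rotate L K (suc b * L + e) ≡ b * L + e
  rotate-block b e e<L = begin
    rotate L K (L + b * L + e)  ≡⟨ rotate-rest (≤-trans (m≤m+n L (b * L)) (m≤m+n _ e)) ⟩
    (L + b * L + e) ∸ L         ≡⟨ cong (_∸ L) (+-assoc L (b * L) e) ⟩
    (L + (b * L + e)) ∸ L       ≡⟨ m+n∸m≡n L (b * L + e) ⟩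
    b * L + e                   ∎
    where open ≡-Reasoning

  iterate-rotate-blocks : ∀ j c e → e < L → iterate (rotate L K) ((j + c) * L + e) j ≡ c * L + e
  iterate-rotate-blocks zero    c e e<L = refl
  iterate-rotate-blocks (suc j) c e e<L =
    trans (cong (λ y → iterate (rotate L K) y j) (rotate-block (j + c) e e<L)) (iterate-rotate-blocks j c e e<L)

  -- b * L + e falls to e in b rotations, jumps to the last block, and falls back in K ∸ b more.
  rotate-period : ∀ x → x < suc K * L → iterate (rotate L K) x (suc K) ≡ x
  rotate-period x x<N with b , e , b≤K , e<L , refl ← block-decomposition (suc K) x x<N = begin
    iterate u (b * L + e) (suc K)          ≡⟨ cong (iterate u (b * L + e)) b+1+d≡1+K ⟨
    iterate u (b * L + e) (b + suc d)      ≡⟨ iterate-+ u b (suc d) ⟩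
    iterate u (iterate u (b * L + e) b) (suc d)
                                           ≡⟨ cong (λ y → iterate u y (suc d)) first-block ⟩
    iterate u (u e) d                      ≡⟨ cong (λ y → iterate u y d) e↦ ⟩
    iterate u ((d + b) * L + e) d          ≡⟨ iterate-rotate-blocks d b e e<L ⟩
    b * L + e                              ∎
    where
    open ≡-Reasoning
    u = rotate L K
    d = K ∸ b
    b+d≡K : b + d ≡ K
    b+d≡K = m+[n∸m]≡n (≤-pred b≤K)
    b+1+d≡1+K : b + suc d ≡ suc K
    b+1+d≡1+K = trans (+-suc b d) (cong suc b+d≡K)
    first-block : iterate u (b * L + e) b ≡ e
    first-block =
      trans (cong (λ c → iterate u (c * L + e) b) (sym (+-identityʳ b))) (iterate-rotate-blocks b 0 e e<L)
    e↦ : u e ≡ (d + b) * L + e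
    e↦ = trans (rotate-first e<L)
               (trans (+-comm e (K * L)) (cong (λ c → c * L + e) (trans (sym b+d≡K) (+-comm b d))))

module _ {n l : ℕ} where

  private
    N = slots n l

  reflectIn∘reflectCircle≡rotate : ∀ {x} → x < N → reflectIn 0 N (reflectCircle N l x) ≡ rotate l n x
  reflectIn∘reflectCircle≡rotate {x} x<N with x <? l
  ... | yes x<l = begin
    reflectIn 0 N (reflectCircle N l x)  ≡⟨ cong (reflectIn 0 N) (reflectCircle-below x<l) ⟩
    N ∸ suc (l ∸ suc x)                  ≡⟨ cong (N ∸_) (+-∸-assoc 1 x<l) ⟨
    (l + n * l) ∸ (l ∸ x)                ≡⟨ cong (λ y → (y + n * l) ∸ (l ∸ x)) (m∸n+n≡m (<⇒≤ x<l)) ⟨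
    ((l ∸ x) + x + n * l) ∸ (l ∸ x)      ≡⟨ cong (_∸ (l ∸ x)) (+-assoc (l ∸ x) x (n * l)) ⟩
    ((l ∸ x) + (x + n * l)) ∸ (l ∸ x)    ≡⟨ m+n∸m≡n (l ∸ x) (x + n * l) ⟩
    x + n * l                            ≡⟨ rotate-first {l} {n} x<l ⟨
    rotate l n x                         ∎
    where open ≡-Reasoning
  ... | no x≮l = begin
    reflectIn 0 N (reflectCircle N l x)  ≡⟨ cong (reflectIn 0 N) (reflectCircle-above l≤x) ⟩
    N ∸ suc ((l + N) ∸ suc x)            ≡⟨ cong (N ∸_) (+-∸-assoc 1 (<-≤-trans x<N (m≤n+m N l))) ⟨
    N ∸ ((l + N) ∸ x)                    ≡⟨ cong (λ z → N ∸ ((l + N) ∸ z)) (m+[n∸m]≡n l≤x) ⟨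
    N ∸ ((l + N) ∸ (l + (x ∸ l)))        ≡⟨ cong (N ∸_) ([m+n]∸[m+o]≡n∸o l N (x ∸ l)) ⟩
    N ∸ (N ∸ (x ∸ l))                    ≡⟨ m∸[m∸n]≡n (≤-trans (m∸n≤m x l) (<⇒≤ x<N)) ⟩
    x ∸ l                                ≡⟨ rotate-rest {l} {n} l≤x ⟨
    rotate l n x                         ∎
    where
    open ≡-Reasoning
    l≤x = ≮⇒≥ x≮l

  rotate-bounded : ∀ x → x < N → rotate l n x < N
  rotate-bounded x x<N = subst (_< N) (reflectIn∘reflectCircle≡rotate x<N)
    (IsCircleReflection.bounded reflectIn-isCircleReflection _ (IsCircleReflection.bounded τ _ x<N))
    where τ = reflectCircle-isCircleReflection {N} {l} (m≤m+n l (n * l))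

  rotate-SameBlock : ∀ {x y} → SameBlock l x y → SameBlock l (rotate l n x) (rotate l n y)
  rotate-SameBlock (b , bl≤x , x<bl+l , bl≤y , y<bl+l) =
    let bl≤ux , ux<bl+l = within-block b bl≤x x<bl+l
        bl≤uy , uy<bl+l = within-block b bl≤y y<bl+l
    in  previous b , bl≤ux , ux<bl+l , bl≤uy , uy<bl+l
    where
    previous : ℕ → ℕ
    previous zero    = n
    previous (suc b) = b
    within-block : ∀ b {i} → b * l ≤ i → i < b * l + l →
                   previous b * l ≤ rotate l n i × rotate l n i < previous b * l + l
    within-block zero {i} _ i<l rewrite rotate-first {l} {n} i<l =
      m≤n+m (n * l) i , subst (_< n * l + l) (+-comm (n * l) i) (+-monoʳ-< (n * l) i<l)
    within-block (suc b) {i} bl≤i i<bl+l rewrite rotate-rest {l} {n} (≤-trans (m≤m+n l (b * l)) bl≤i) =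
      m+n≤o⇒m≤o∸n (b * l) (subst (_≤ i) (+-comm l (b * l)) bl≤i) ,
      subst (i ∸ l <_) (trans (cong (_∸ l) (+-assoc l (b * l) l)) (m+n∸m≡n l (b * l + l)))
        (∸-monoˡ-< i<bl+l (≤-trans (m≤m+n l (b * l)) bl≤i))

-- Iterating s_{1,n} s_{1,n-1}

module _ (n p q : ℕ) (L : List ℕ) {k : ℕ} (k<n : k < n) where

  private
    choose : Bool → ℕ
    choose b = if b then nth L ((p + q) ∸ suc (suc k)) else nth L k

  nth-actLabels-inside : Within p (suc q) (suc k) → nth (actLabels n p q L) k ≡ nth L ((p + q) ∸ suc (suc k))
  nth-actLabels-inside inside =
    trans (nth-map-upTo _ n k<n) (cong choose (dec-true (within? p (suc q) (suc k)) inside))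

  nth-actLabels-outside : ¬ Within p (suc q) (suc k) → nth (actLabels n p q L) k ≡ nth L k
  nth-actLabels-outside outside =
    trans (nth-map-upTo _ n k<n) (cong choose (dec-false (within? p (suc q) (suc k)) outside))

record WellFormed (n l : ℕ) (D : Diagram) : Set where
  field
    labels-length : length (labels D) ≡ n
    arcs-length   : length (arcs D) ≡ slots n l
    isArcMatching : IsArcMatching n l (nth (arcs D))

  open IsArcMatching isArcMatching public

X-wellFormed : ∀ {n l} (x : X n l) → WellFormed n l (X.diag x)
X-wellFormed {n} (mkX D valid) = record
  { labels-length = trans (↭-length labelsPerm) (length-applyUpTo suc n)
  ; arcs-length   = arcsLength
  ; isArcMatching = record
    { isNonCrossingMatching = record { bounded = inRange ; involutive = involutive ; nonCrossing = nonCrossing }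
    ; noLoop                = noSelf
    }
  }
  where open IsArcDiagram valid

module Dynamics (n′ l : ℕ) where

  n = suc n′
  N = slots n l
  ρ = reflectIn 0 N
  τ = reflectCircle N l
  u = rotate l n

  step : Diagram → Diagram
  step D = actGen n l (1 , n) (actGen n l (1 , n′) D)

  act-theWord : ∀ D → act n l (theWord n) D ≡ fold D step (n * suc n)
  act-theWord D = go (n * suc n)
    where
    go : ∀ j → act n l (concat (replicate j ((1 , n) ∷ (1 , n′) ∷ []))) D ≡ fold D step j
    go zero    = refl
    go (suc j) = cong step (go j)

  labels-step : ∀ D j → j < n → nth (labels (step D)) j ≡ nth (labels D) (rotate 1 n′ j)
  labels-step D j j<n = trans (nth-actLabels-inside n 1 n L₁ j<n (s≤s z≤n , s≤s j<n)) (last-moves-first j j<n)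
    where
    L₁ = actLabels n 1 n′ (labels D)
    last-moves-first : ∀ j → j < n → nth L₁ (n′ ∸ j) ≡ nth (labels D) (rotate 1 n′ j)
    last-moves-first zero _ = begin
      nth L₁ n′                    ≡⟨ nth-actLabels-outside n 1 n′ (labels D) ≤-refl
                                         (λ (_ , n′<n′) → <-irrefl refl n′<n′) ⟩
      nth (labels D) n′            ≡⟨ cong (nth (labels D)) (*-identityʳ n′) ⟨
      nth (labels D) (n′ * 1)      ≡⟨ cong (nth (labels D)) (rotate-first {1} {n′} (s≤s z≤n)) ⟨
      nth (labels D) (rotate 1 n′ 0) ∎
      where open ≡-Reasoning
    last-moves-first (suc j) (s≤s j<n′) = begin
      nth L₁ (n′ ∸ suc j)          ≡⟨ nth-actLabels-inside n 1 n′ (labels D) (<-trans i<n′ (n<1+n n′))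
                                         (s≤s z≤n , s≤s i<n′) ⟩
      nth (labels D) (n′ ∸ suc i)  ≡⟨ cong (nth (labels D)) (m∸[1+[m∸[1+n]]]≡n j<n′) ⟩
      nth (labels D) j             ≡⟨ cong (nth (labels D)) (rotate-rest {1} {n′} (s≤s z≤n)) ⟨
      nth (labels D) (rotate 1 n′ (suc j)) ∎
      where
      open ≡-Reasoning
      i = n′ ∸ suc j
      i<n′ : i < n′
      i<n′ = m∸[1+n]<m j<n′

  ρ-reflection : IsCircleReflection N N ρ
  ρ-reflection = reflectIn-isCircleReflection

  τ-reflection : IsCircleReflection N l τ
  τ-reflection = reflectCircle-isCircleReflection (m≤m+n l (n * l))

  module ρ = IsCircleReflection ρ-reflection
  module τ = IsCircleReflection τ-reflection

  module _ {D : Diagram} (W : WellFormed n l D) where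

    open WellFormed W

    private
      m = nth (arcs D)
      M₁ = actArcs n l 1 n′ (arcs D)

    nth-s₁ₙ₋₁ : ∀ x → x < N → nth M₁ x ≡ ρ (m (ρ x))
    nth-s₁ₙ₋₁ x x<N = begin
      nth M₁ x                                      ≡⟨ nth-actArcs n l 1 n′ (arcs D) x<N ⟩
      ChordReflection.rejoin N (1 * l) (n * l) m x  ≡⟨ cong (λ lo → ChordReflection.rejoin N lo (n * l) m x)
                                                            (*-identityˡ l) ⟩
      ChordReflection.rejoin N l (n * l) m x        ≡⟨ Rainbow.rejoin-ρ (s≤s z≤n) isArcMatching x x<N ⟩
      ρ (m (ρ x))                                   ∎
      where open ≡-Reasoning

    M₁-nonCrossing : IsNonCrossingMatching N (nth M₁)
    M₁-nonCrossing = IsNonCrossingMatching-resp nth-s₁ₙ₋₁ (conjugate-nonCrossing ρ-reflection isNonCrossingMatching)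

    M₁-first-block-leaves : ∀ o → o < l → l ≤ nth M₁ o
    M₁-first-block-leaves o o<l = subst (l ≤_) (sym (nth-s₁ₙ₋₁ o o<N)) (m+n≤o⇒m≤o∸n l (+-monoʳ-≤ l mρo<nl))
      where
      o<N = Rainbow.<l⇒<N (s≤s z≤n) isArcMatching o<l
      mρo<nl : m (ρ o) < n * l
      mρo<nl = Rainbow.leaves-last-block (s≤s z≤n) isArcMatching (ρ o)
                 (Rainbow.ρ-first→last (s≤s z≤n) isArcMatching o o<l) (ρ.bounded o o<N)

    nth-step : ∀ x → x < N → nth (arcs (step D)) x ≡ τ (ρ (m (ρ (τ x))))
    nth-step x x<N = begin
      nth (arcs (step D)) x                          ≡⟨ nth-actArcs n l 1 n M₁ x<N ⟩
      ChordReflection.rejoin N (1 * l) N (nth M₁) x  ≡⟨ cong (λ lo → ChordReflection.rejoin N lo N (nth M₁) x)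
                                                           (*-identityˡ l) ⟩
      ChordReflection.rejoin N l N (nth M₁) x        ≡⟨ rejoin-reflectCircle (m≤m+n l (n * l)) M₁-nonCrossing
                                                           M₁-first-block-leaves x x<N ⟩
      τ (nth M₁ (τ x))                               ≡⟨ cong τ (nth-s₁ₙ₋₁ (τ x) (τ.bounded x x<N)) ⟩
      τ (ρ (m (ρ (τ x))))                            ∎
      where open ≡-Reasoning

    -- ρ ∘ τ = u, so one step conjugates the matching by the rotation u.
    rotate-step : ∀ x → x < N → u (nth (arcs (step D)) x) ≡ m (u x)
    rotate-step x x<N = begin
      u (nth (arcs (step D)) x)      ≡⟨ reflectIn∘reflectCircle≡rotate {n} {l} m′x<N ⟨
      ρ (τ (nth (arcs (step D)) x))  ≡⟨ cong (ρ ∘ τ) (nth-step x x<N) ⟩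
      ρ (τ (τ (ρ (m (ρ (τ x))))))    ≡⟨ cong ρ (τ.involutive _ ρmρτx<N) ⟩
      ρ (ρ (m (ρ (τ x))))            ≡⟨ ρ.involutive _ mρτx<N ⟩
      m (ρ (τ x))                    ≡⟨ cong m (reflectIn∘reflectCircle≡rotate {n} {l} x<N) ⟩
      m (u x)                        ∎
      where
      open ≡-Reasoning
      mρτx<N = bounded _ (ρ.bounded _ (τ.bounded x x<N))
      ρmρτx<N = ρ.bounded _ mρτx<N
      m′x<N = subst (_< N) (sym (nth-step x x<N)) (τ.bounded _ ρmρτx<N)

    step-wellFormed : WellFormed n l (step D)
    step-wellFormed = record
      { labels-length = trans (length-map _ (upTo n)) (length-upTo n)
      ; arcs-length   = trans (length-map _ (upTo N)) (length-upTo N)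
      ; isArcMatching = record
        { isNonCrossingMatching = IsNonCrossingMatching-resp nth-step
            (conjugate-nonCrossing τ-reflection (conjugate-nonCrossing ρ-reflection isNonCrossingMatching))
        ; noLoop = λ x x<N same → noLoop (u x) (rotate-bounded {n} {l} x x<N)
            (subst (SameBlock l (u x)) (rotate-step x x<N) (rotate-SameBlock {n} {l} same))
        }
      }

  steps-wellFormed : ∀ {D} → WellFormed n l D → ∀ j → WellFormed n l (fold D step j)
  steps-wellFormed W zero    = W
  steps-wellFormed W (suc j) = step-wellFormed (steps-wellFormed W j)

  rotate-steps : ∀ {D} → WellFormed n l D → ∀ j x → x < N →
                 iterate u (nth (arcs (fold D step j)) x) j ≡ nth (arcs D) (iterate u x j)
  rotate-steps W zero    x x<N = refl
  rotate-steps W (suc j) x x<N =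
    trans (cong (λ y → iterate u y j) (rotate-step (steps-wellFormed W j) x x<N))
          (rotate-steps W j (u x) (rotate-bounded {n} {l} x x<N))

  g = rotate 1 n′

  g-bounded : ∀ i → i < n → g i < n
  g-bounded i i<n =
    subst (g i <_) (*-identityʳ n) (rotate-bounded {n′} {1} i (subst (i <_) (sym (*-identityʳ n)) i<n))

  labels-steps : ∀ D j i → i < n → nth (labels (fold D step j)) i ≡ nth (labels D) (iterate g i j)
  labels-steps D zero    i i<n = refl
  labels-steps D (suc j) i i<n = trans (labels-step (fold D step j) i i<n) (labels-steps D j (g i) (g-bounded i i<n))

  fold-step-period : ∀ {D} → WellFormed n l D → fold D step (n * suc n) ≡ D
  fold-step-period {D} W = cong₂ diagram labels-≡ arcs-≡
    where
    open ≡-Reasoning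
    D′ = fold D step (n * suc n)
    module W = WellFormed W
    module W′ = WellFormed (steps-wellFormed W (n * suc n))
    u-period : ∀ x → x < N → iterate u x (n * suc n) ≡ x
    u-period x = iterate-periodic u {c = suc n} (rotate-period {l} {n}) n
    g-period : ∀ i → i < n → iterate g i (n * suc n) ≡ i
    g-period i i<n = subst (λ k → iterate g i k ≡ i) (*-comm (suc n) n)
      (iterate-periodic g {c = n} (λ y y<n → rotate-period {1} {n′} y (subst (y <_) (sym (*-identityʳ n)) y<n))
                        (suc n) i<n)
    arcs-≡ : arcs D′ ≡ arcs D
    arcs-≡ = ≡-from-nth _ _ (trans W′.arcs-length (sym W.arcs-length)) λ x x<len →
      let x<N = subst (x <_) W′.arcs-length x<len in begin
      nth (arcs D′) x                             ≡⟨ u-period _ (W′.bounded x x<N) ⟨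
      iterate u (nth (arcs D′) x) (n * suc n)     ≡⟨ rotate-steps W (n * suc n) x x<N ⟩
      nth (arcs D) (iterate u x (n * suc n))      ≡⟨ cong (nth (arcs D)) (u-period x x<N) ⟩
      nth (arcs D) x                              ∎
    labels-≡ : labels D′ ≡ labels D
    labels-≡ = ≡-from-nth _ _ (trans W′.labels-length (sym W.labels-length)) λ i i<len →
      let i<n = subst (i <_) W′.labels-length i<len in
      trans (labels-steps D (n * suc n) i i<n) (cong (nth (labels D)) (g-period i i<n))

-- The hypothesis 2 ≤ n is only needed to exclude n = 0: the argument works for every n ≥ 1.
theorem8p2 : (n l : ℕ) → 2 ≤ n → (x : X n l) →
    act n l (theWord n) (X.diag x) ≡ X.diag x
theorem8p2 zero     l () x
theorem8p2 (suc n′) l _  x = trans (act-theWord (X.diag x)) (fold-step-period (X-wellFormed x))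
  where open Dynamics n′ l
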